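{- For all bouquets $\Phi,\Psi$: if $\Phi\to_{\mathsf C}\Psi$ is an instance of a cultural rule (grow, crop, pull, glue, apis or apet), then $\Psi\models\Phi$.
   Context: Fix a countable set $\mathcal{V}$ of variables and a first-order signature: a countable set $\mathcal{P}$ of predicate symbols with arities $\mathrm{ar}:\mathcal{P}\to\mathbb{N}$. Flowers and gardens by mutual induction: atoms $p(\vec x)$ ($\vec x\in\mathcal V^{\mathrm{ar}(p)}$) are flowers; if $\mathbf{x}\subset\mathcal{V}$ is finite (a sprinkler) and $\Phi$ a finite multiset of flowers (a bouquet), $\mathbf{x}\cdot\Phi$ is a garden; if $\gamma$ is a garden (pistil) and $\Delta$ a finite multiset of gardens (petals), $\gamma\rhd\Delta$ is a flower, also written $\gamma\rhd\delta_1;\dots;\delta_n$. $\emptyset\cdot\Phi$ is written $\Phi$; $\emptyset$ is the empty bouquet; comma is multiset union; $\mathbf x,\mathbf y$ denotes $\mathbf x\cup\mathbf y$. Free variables: $\mathrm{fv}(p(\vec x))$ = variables of $\vec x$; $\mathrm{fv}(\Phi)=\bigcup\mathrm{fv}(\phi)$; $\mathrm{fv}(\mathbf{x}\cdot\Phi)=\mathrm{fv}(\Phi)\setminus\mathbf{x}$; $\mathrm{fv}(\mathbf{x}\cdot\Phi\rhd\Delta)=\mathrm{fv}(\mathbf{x}\cdot\Phi)\cup\bigcup_{\mathbf{y}\cdot\Psi\in\Delta}\mathrm{fv}((\mathbf{x}\cup\mathbf{y})\cdot\Psi)$. Bound variables: $\mathrm{bv}(p(\vec x))=\emptyset$, $\mathrm{bv}(\Phi)=\bigcup\mathrm{bv}(\phi)$,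 $\mathrm{bv}(\mathbf x\cdot\Phi)=\mathbf x\cup\mathrm{bv}(\Phi)$, $\mathrm{bv}(\gamma\rhd\Delta)=\mathrm{bv}(\gamma)\cup\bigcup_{\delta\in\Delta}\mathrm{bv}(\delta)$. Standing convention: every bouquet considered has pairwise distinct binders and $\mathrm{bv}(\Phi)\cap\mathrm{fv}(\Phi)=\emptyset$. Substitutions: $f[R\mapsto g]$ equals $g$ on $R$ and $f$ elsewhere. A substitution is $\sigma:\mathcal V\to\mathcal V$ with finite support; $\sigma:\mathbf y$ means support $\mathbf y$; $\sigma_{ -\mathbf x}:=\sigma[\mathbf x\mapsto\mathrm{id}]$. Action: $\sigma(p(x_1,\dots,x_n))=p(\sigma(x_1),\dots,\sigma(x_n))$, elementwise on bouquets, $\sigma(\mathbf x\cdot\Phi)=\mathbf x\cdot\sigma_{ -\mathbf x}(\Phi)$, $\sigma(\mathbf x\cdot\Phi\rhd\delta_1;\dots;\delta_n)=\sigma(\mathbf x\cdot\Phi)\rhd\sigma_{ -\mathbf x}(\delta_1);\dots;\sigma_{ -\mathbf x}(\delta_n)$. $\sigma:\mathbf y$ is capture-avoiding in $\Phi$ if $\sigma(\mathbf y)\cap\mathrm{bv}(\Phi)=\emptyset$. Contexts: $\Xi::=\Psi,\xi$, $\xi::=\Box\mid(\mathbf x\cdot\Xi\rhd\Delta)\mid(\gamma\rhd\mathbf x\cdot\Xi;\Delta)$; $\Xi\{\Psi\}$ fills the hole with bouquet $\Psi$, $\Xi\{\}$ with $\emptyset$. Inversions: $\mathrm{inv}(\Box)=0$,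 $\mathrm{inv}(\Psi,\xi)=\mathrm{inv}(\xi)$, $\mathrm{inv}(\mathbf x\cdot\Xi\rhd\Delta)=1+\mathrm{inv}(\Xi)$, $\mathrm{inv}(\gamma\rhd\mathbf x\cdot\Xi;\Delta)=\mathrm{inv}(\Xi)$; positive contexts $\Xi^+$ have even, negative $\Xi^-$ odd inversions. Cultural rules $\mathsf C$ (conclusion $\to$ premiss): (grow) $\Xi^+\{\}\to\Xi^+\{\Phi\}$; (crop) $\Xi^-\{\Phi\}\to\Xi^-\{\}$; (pull) $\Xi^+\{\gamma\rhd\Gamma;\Delta\}\to\Xi^+\{\gamma\rhd\Delta\}$; (glue) $\Xi^-\{\gamma\rhd\Delta\}\to\Xi^-\{\gamma\rhd\Gamma;\Delta\}$; (apis) $\Xi^+\{\mathbf x\cdot\sigma(\Phi)\rhd\sigma(\Delta)\}\to\Xi^+\{\mathbf x,\mathbf y\cdot\Phi\rhd\Delta\}$ with $\sigma:\mathbf y$ capture-avoiding in $(\emptyset\cdot\Phi\rhd\Delta)$; (apet) $\Xi^-\{\gamma\rhd\mathbf x\cdot\sigma(\Phi);\Delta\}\to\Xi^-\{\gamma\rhd\mathbf x,\mathbf y\cdot\Phi;\Delta\}$ with $\sigma:\mathbf y$ capture-avoiding in $\Phi$. Here $\Gamma,\Delta$ are corollas. Semantics: a Kripke structure $(W,\le,(M_w)_{w\in W})$ has a preorder $\le$ on worlds and for each $w$ a nonempty domain $M_w$ and relations $[\![p]\!]_w\subseteq M_w^{\mathrm{ar}(p)}$, monotone along $\le$. A $w$-evaluation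 is $e:\mathcal V\to M_w$. Forcing: $w\Vdash_e p(x_1,\dots,x_n)$ iff $(e(x_1),\dots,e(x_n))\in[\![p]\!]_w$; $w\Vdash_e\Phi$ iff $w\Vdash_e\phi$ for all $\phi\in\Phi$; $w\Vdash_e(\mathbf x\cdot\Phi\rhd\mathbf x_1\cdot\Phi_1;\dots;\mathbf x_n\cdot\Phi_n)$ iff for every $w'\ge w$ and $w'$-evaluation $e'$ with $w'\Vdash_{e[\mathbf x\mapsto e']}\Phi$, there are $i$ and a $w'$-evaluation $e''$ with $w'\Vdash_{e[\mathbf x\mapsto e'][\mathbf x_i\mapsto e'']}\Phi_i$. $\Phi\models\Psi$ means that in every Kripke structure, at every world $w$ and $w$-evaluation $e$, $w\Vdash_e\Phi$ implies $w\Vdash_e\Psi$. -}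

module Defs where

open import Data.Nat using (ℕ; zero; suc; _%_; _≟_)
open import Data.List using (List; []; _∷_; _++_; [_]; filter; concat)
import Data.Vec as Vec
open import Data.Vec using (Vec)
open import Data.Product using (Σ; ∃; _×_; _,_)
open import Data.Sum using (_⊎_)
open import Data.Unit using (⊤)
open import Data.Empty using (⊥)
open import Relation.Nullary using (¬_; yes; no)
open import Relation.Nullary.Decidable using (¬?)
open import Relation.Binary.PropositionalEquality using (_≡_)
open import Data.List.Membership.DecPropositional _≟_ using (_∈_; _∉_; _∈?_)
open import Data.List.Relation.Unary.AllPairs using (AllPairs)
import Data.List.Relation.Binary.Permutation.Homogeneous as PermH
open import Function.Definitions using (Injective)

-- Signature: a countable set of predicate symbols with arities
-- (countability: an injection into ℕ).  Variables 𝒱 = ℕ.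

record Signature : Set₁ where
  field
    Pred     : Set
    ar       : Pred → ℕ
    code     : Pred → ℕ
    code-inj : Injective _≡_ _≡_ code

Var : Set
Var = ℕ

-- sprinklers: finite sets of variables, represented by lists
-- (only membership matters; 𝐱,𝐲 is list append)
Sprinkler : Set
Sprinkler = List Var

module _ (S : Signature) where
  open Signature S

  -- Flowers and gardens (multisets represented by lists)

  infix 6 _·_
  infix 5 _▷_

  mutual
    data Flower : Set where
      atom : (p : Pred) → Vec Var (ar p) → Flower
      _▷_  : Garden → List Garden → Flower

    data Garden : Set where
      _·_ : Sprinkler → List Flower → Garden

  Bouquet : Set
  Bouquet = List Flower

  Corolla : Set
  Corolla = List Garden

  notIn : Sprinkler → List Var → List Var
  notIn x vs = filter (λ v → ¬? (v ∈? x)) vs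

  mutual
    fvF : Flower → List Var
    fvF (atom p xs) = Vec.toList xs
    fvF ((x · Φ) ▷ Δ) = notIn x (fvB Φ) ++ fvPetals x Δ

    fvPetals : Sprinkler → Corolla → List Var
    fvPetals x [] = []
    fvPetals x ((y · Ψ) ∷ Δ) = notIn (x ++ y) (fvB Ψ) ++ fvPetals x Δ

    fvB : Bouquet → List Var
    fvB [] = []
    fvB (φ ∷ Φ) = fvF φ ++ fvB Φ

  fvG : Garden → List Var
  fvG (x · Φ) = notIn x (fvB Φ)

  mutual
    bvF : Flower → List Var
    bvF (atom p xs) = []
    bvF (γ ▷ Δ) = bvG γ ++ bvC Δ

    bvG : Garden → List Var
    bvG (x · Φ) = x ++ bvB Φ

    bvC : Corolla → List Var
    bvC [] = []
    bvC (δ ∷ Δ) = bvG δ ++ bvC Δ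

    bvB : Bouquet → List Var
    bvB [] = []
    bvB (φ ∷ Φ) = bvF φ ++ bvB Φ

  mutual
    bindersF : Flower → List Sprinkler
    bindersF (atom p xs) = []
    bindersF (γ ▷ Δ) = bindersG γ ++ bindersC Δ

    bindersG : Garden → List Sprinkler
    bindersG (x · Φ) = x ∷ bindersB Φ

    bindersC : Corolla → List Sprinkler
    bindersC [] = []
    bindersC (δ ∷ Δ) = bindersG δ ++ bindersC Δ

    bindersB : Bouquet → List Sprinkler
    bindersB [] = []
    bindersB (φ ∷ Φ) = bindersF φ ++ bindersB Φ

  Disjoint : List Var → List Var → Set
  Disjoint xs ys = ∀ v → v ∈ xs → v ∉ ys

  WellFormed : Bouquet → Set
  WellFormed Φ = AllPairs Disjoint (bindersB Φ) × Disjoint (bvB Φ) (fvB Φ)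

  override : {A : Set} → Sprinkler → (Var → A) → (Var → A) → Var → A
  override R f g v with v ∈? R
  ... | yes _ = g v
  ... | no _  = f v

  _₋_ : (Var → Var) → Sprinkler → Var → Var
  σ ₋ x = override x σ (λ v → v)

  HasSupport : (Var → Var) → Sprinkler → Set
  HasSupport σ y = ∀ v → (v ∈ y → ¬ (σ v ≡ v)) × (v ∉ y → σ v ≡ v)

  CaptureAvoiding : (Var → Var) → Sprinkler → List Var → Set
  CaptureAvoiding σ y bv = ∀ v → v ∈ y → σ v ∉ bv

  mutual
    substF : (Var → Var) → Flower → Flower
    substF σ (atom p xs) = atom p (Vec.map σ xs)
    substF σ ((x · Φ) ▷ Δ) = (x · substB (σ ₋ x) Φ) ▷ substC (σ ₋ x) Δ

    substG : (Var → Var) → Garden → Garden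
    substG σ (x · Φ) = x · substB (σ ₋ x) Φ

    substC : (Var → Var) → Corolla → Corolla
    substC σ [] = []
    substC σ (δ ∷ Δ) = substG σ δ ∷ substC σ Δ

    substB : (Var → Var) → Bouquet → Bouquet
    substB σ [] = []
    substB σ (φ ∷ Φ) = substF σ φ ∷ substB σ Φ

  mutual
    data Ctx : Set where
      _,,_ : Bouquet → FCtx → Ctx

    data FCtx : Set where
      □     : FCtx
      pist  : Sprinkler → Ctx → Corolla → FCtx
      petal : Garden → Sprinkler → Ctx → Corolla → FCtx

  mutual
    fill : Ctx → Bouquet → Bouquet
    fill (Ψ ,, ξ) Θ = Ψ ++ fillF ξ Θ

    fillF : FCtx → Bouquet → Bouquet
    fillF □ Θ = Θ
    fillF (pist x Ξ Δ) Θ = [ (x · fill Ξ Θ) ▷ Δ ]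
    fillF (petal γ x Ξ Δ) Θ = [ γ ▷ ((x · fill Ξ Θ) ∷ Δ) ]

  mutual
    inv : Ctx → ℕ
    inv (Ψ ,, ξ) = invF ξ

    invF : FCtx → ℕ
    invF □ = 0
    invF (pist x Ξ Δ) = suc (inv Ξ)
    invF (petal γ x Ξ Δ) = inv Ξ

  Positive : Ctx → Set
  Positive Ξ = inv Ξ % 2 ≡ 0

  Negative : Ctx → Set
  Negative Ξ = inv Ξ % 2 ≡ 1

  -- Cultural rules, on list representatives:  conclusion ⟶ premiss

  data _⟶ᶜ_ : Bouquet → Bouquet → Set where
    grow : ∀ {Ξ Φ} → Positive Ξ → fill Ξ [] ⟶ᶜ fill Ξ Φ
    crop : ∀ {Ξ Φ} → Negative Ξ → fill Ξ Φ ⟶ᶜ fill Ξ []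
    pull : ∀ {Ξ γ Γ Δ} → Positive Ξ →
           fill Ξ [ γ ▷ (Γ ++ Δ) ] ⟶ᶜ fill Ξ [ γ ▷ Δ ]
    glue : ∀ {Ξ γ Γ Δ} → Negative Ξ →
           fill Ξ [ γ ▷ Δ ] ⟶ᶜ fill Ξ [ γ ▷ (Γ ++ Δ) ]
    apis : ∀ {Ξ x y σ Φ Δ} → Positive Ξ → HasSupport σ y →
           CaptureAvoiding σ y (bvF (([] · Φ) ▷ Δ)) →
           fill Ξ [ (x · substB σ Φ) ▷ substC σ Δ ] ⟶ᶜ fill Ξ [ ((x ++ y) · Φ) ▷ Δ ]
    apet : ∀ {Ξ γ x y σ Φ Δ} → Negative Ξ → HasSupport σ y →
           CaptureAvoiding σ y (bvB Φ) →
           fill Ξ [ γ ▷ ((x · substB σ Φ) ∷ Δ) ] ⟶ᶜ fill Ξ [ γ ▷ (((x ++ y) · Φ) ∷ Δ) ]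

  -- Syntactic identity of the paper: bouquets/corollas are multisets and
  -- sprinklers are sets, so lists are identified up to permutation
  -- (deeply) and sprinklers up to having the same elements.

  mutual
    data _≈F_ : Flower → Flower → Set where
      atom≈ : ∀ {p xs} → atom p xs ≈F atom p xs
      ▷≈    : ∀ {γ γ' Δ Δ'} → γ ≈G γ' → PermH.Permutation _≈G_ Δ Δ' →
              (γ ▷ Δ) ≈F (γ' ▷ Δ')

    data _≈G_ : Garden → Garden → Set where
      ·≈ : ∀ {x x' Φ Φ'} → (∀ v → v ∈ x → v ∈ x') → (∀ v → v ∈ x' → v ∈ x) →
           PermH.Permutation _≈F_ Φ Φ' → (x · Φ) ≈G (x' · Φ')

  _≈B_ : Bouquet → Bouquet → Set
  _≈B_ = PermH.Permutation _≈F_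

  _⟶C_ : Bouquet → Bouquet → Set
  Φ ⟶C Ψ = Σ Bouquet λ Φ' → Σ Bouquet λ Ψ' → Φ ≈B Φ' × Ψ ≈B Ψ' × Φ' ⟶ᶜ Ψ'

  -- Kripke semantics.  Domains M_w are subsets (predicate Dom w) of a
  -- global carrier D, increasing along ≤.

  record Kripke : Set₁ where
    field
      W        : Set
      _≤_      : W → W → Set
      ≤-refl   : ∀ {w} → w ≤ w
      ≤-trans  : ∀ {u v w} → u ≤ v → v ≤ w → u ≤ w
      D        : Set
      Dom      : W → D → Set
      Dom-mono : ∀ {w w' d} → w ≤ w' → Dom w d → Dom w' d
      nonempty : ∀ w → Σ D (Dom w)
      ⟦_⟧      : (p : Pred) → W → Vec D (ar p) → Set
      ⟦⟧-dom   : ∀ {p w ds} → ⟦ p ⟧ w ds → ∀ i → Dom w (Vec.lookup ds i)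
      ⟦⟧-mono  : ∀ {p w w' ds} → w ≤ w' → ⟦ p ⟧ w ds → ⟦ p ⟧ w' ds

  module _ (K : Kripke) where
    open Kripke K

    Eval : W → (Var → D) → Set
    Eval w e = ∀ v → Dom w (e v)

    mutual
      forceF : W → (Var → D) → Flower → Set
      forceF w e (atom p xs) = ⟦ p ⟧ w (Vec.map e xs)
      forceF w e ((x · Φ) ▷ Δ) =
        ∀ w' → w ≤ w' → ∀ e' → Eval w' e' →
        forceB w' (override x e e') Φ → forcePetals w' (override x e e') Δ

      forcePetals : W → (Var → D) → Corolla → Set
      forcePetals w e [] = ⊥
      forcePetals w e ((y · Ψ) ∷ Δ) =
        (Σ (Var → D) λ e'' → Eval w e'' × forceB w (override y e e'') Ψ)
        ⊎ forcePetals w e Δ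

      forceB : W → (Var → D) → Bouquet → Set
      forceB w e [] = ⊤
      forceB w e (φ ∷ Φ) = forceF w e φ × forceB w e Φ

  _⊨_ : Bouquet → Bouquet → Set₁
  Φ ⊨ Ψ = ∀ (K : Kripke) (w : Kripke.W K) (e : Var → Kripke.D K) →
          Eval K w e → forceB K w e Φ → forceB K w e Ψ

-- Forcing is invariant under the multiset and set identifications (≈), so it suffices to treat
-- rule instances on list representatives.  Locally, the premiss of grow, pull and apis entails
-- the conclusion, and the conclusion of crop, glue and apet entails the premiss.  For apis and
-- apet this is instantiation: a pistil quantifies universally over its sprinkler and a petal
-- existentially, and forcing σ(φ) under e is forcing φ under e ∘ σ as long as σ moves no
-- variable onto a binder of φ.  Filling a context is monotone in the hole except that each
-- pistil on the way to the hole reverses the direction, so the parity of the inversion count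
-- decides in which direction the whole bouquets are related.
module Submission where

open import Defs
open import Data.Nat using (zero; suc; _%_; _≟_)
open import Data.List using (List; []; _∷_; _++_; [_])
open import Data.List.Membership.DecPropositional _≟_ using (_∈_; _∉_; _∈?_)
open import Data.List.Membership.Propositional.Properties using (∈-++⁺ˡ; ∈-++⁺ʳ)
open import Data.List.Relation.Binary.Pointwise using (Pointwise; []; _∷_)
open import Data.List.Relation.Binary.Permutation.Homogeneous as Perm using (Permutation)
open import Data.Product using (Σ; _×_; _,_; proj₂)
open import Data.Product.Function.NonDependent.Propositional using (_×-⇔_)
open import Data.Sum using (_⊎_; inj₂; assocˡ; assocʳ)
import Data.Sum as Sum
open import Data.Sum.Function.Propositional using (_⊎-⇔_)
open import Data.Unit using (tt)
import Data.Vec as Vec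
import Data.Vec.Properties as Vec
open import Function using (_∘_)
open import Function.Bundles using (_⇔_; mk⇔; Equivalence)
import Function.Properties.Equivalence as ⇔
open import Relation.Nullary using (yes; no; contradiction)
open import Relation.Binary.PropositionalEquality
  using (_≡_; _≢_; _≗_; refl; sym; trans; cong; subst; module ≡-Reasoning)

open Equivalence using (to; from)

private variable
  A B C A′ B′ C′ : Set

≡⇒⇔ : A ≡ B → A ⇔ B
≡⇒⇔ refl = ⇔.refl

⊎-swapˡ-⇔ : A ⇔ A′ → B ⇔ B′ → C ⇔ C′ → (A ⊎ B ⊎ C) ⇔ (B′ ⊎ A′ ⊎ C′)
⊎-swapˡ-⇔ A⇔ B⇔ C⇔ = ⇔.trans (A⇔ ⊎-⇔ B⇔ ⊎-⇔ C⇔) (mk⇔ swapˡ swapˡ)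
  where
  swapˡ : ∀ {X Y Z : Set} → X ⊎ Y ⊎ Z → Y ⊎ X ⊎ Z
  swapˡ = assocʳ ∘ Sum.map₁ Sum.swap ∘ assocˡ

×-swapˡ-⇔ : A ⇔ A′ → B ⇔ B′ → C ⇔ C′ → (A × B × C) ⇔ (B′ × A′ × C′)
×-swapˡ-⇔ A⇔ B⇔ C⇔ = ⇔.trans (A⇔ ×-⇔ B⇔ ×-⇔ C⇔) (mk⇔ swapˡ swapˡ)
  where
  swapˡ : ∀ {X Y Z : Set} → X × Y × Z → Y × X × Z
  swapˡ (x , y , z) = y , x , z

even-suc⇒odd : ∀ n → suc n % 2 ≡ 0 → n % 2 ≡ 1
even-suc⇒odd zero ()
even-suc⇒odd (suc zero) _ = refl
even-suc⇒odd (suc (suc n)) = even-suc⇒odd n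

odd-suc⇒even : ∀ n → suc n % 2 ≡ 1 → n % 2 ≡ 0
odd-suc⇒even zero _ = refl
odd-suc⇒even (suc zero) ()
odd-suc⇒even (suc (suc n)) = odd-suc⇒even n

module _ (S : Signature) where

  override-∈ : ∀ {A : Set} {x v} (f g : Var → A) → v ∈ x → override S x f g v ≡ g v
  override-∈ {x = x} {v} f g v∈x with v ∈? x
  ... | yes _ = refl
  ... | no v∉x = contradiction v∈x v∉x

  override-∉ : ∀ {A : Set} {x v} (f g : Var → A) → v ∉ x → override S x f g v ≡ f v
  override-∉ {x = x} {v} f g v∉x with v ∈? x
  ... | yes v∈x = contradiction v∈x v∉x
  ... | no _ = refl

  override-cong : ∀ {A : Set} {x x′} {f f′ : Var → A} (g : Var → A) →
                  (∀ v → v ∈ x → v ∈ x′) → (∀ v → v ∈ x′ → v ∈ x) → f ≗ f′ →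
                  override S x f g ≗ override S x′ f′ g
  override-cong {x = x} {x′} g x⊆x′ x′⊆x f≗f′ v with v ∈? x | v ∈? x′
  ... | yes _ | yes _ = refl
  ... | no _ | no _ = f≗f′ v
  ... | yes v∈x | no v∉x′ = contradiction (x⊆x′ v v∈x) v∉x′
  ... | no v∉x | yes v∈x′ = contradiction (x′⊆x v v∈x′) v∉x

  -- A support-free form of CaptureAvoiding; unlike that one it is inherited by σ ₋ x.
  CaptureFree : (Var → Var) → List Var → Set
  CaptureFree σ B = ∀ v → σ v ≢ v → σ v ∉ B

  CaptureFree-++ : ∀ {σ} B C → CaptureFree σ (B ++ C) → CaptureFree σ B × CaptureFree σ C
  CaptureFree-++ B C cf = (λ v σv≢v → cf v σv≢v ∘ ∈-++⁺ˡ) , (λ v σv≢v → cf v σv≢v ∘ ∈-++⁺ʳ B)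

  CaptureFree-split : ∀ {σ} x B C → CaptureFree σ ((x ++ B) ++ C) →
                      CaptureFree σ x × CaptureFree σ B × CaptureFree σ C
  CaptureFree-split x B C cf =
    let cfxB , cfC = CaptureFree-++ (x ++ B) C cf
        cfx , cfB = CaptureFree-++ x B cfxB
    in cfx , cfB , cfC

  CaptureFree-₋ : ∀ {σ B} x → CaptureFree σ B → CaptureFree (_₋_ S σ x) B
  CaptureFree-₋ {σ} x cf v with v ∈? x
  ... | yes _ = λ v≢v → contradiction refl v≢v
  ... | no _ = cf v

  CaptureAvoiding⇒CaptureFree : ∀ {σ y B} → HasSupport S σ y → CaptureAvoiding S σ y B →
                                CaptureFree σ B
  CaptureAvoiding⇒CaptureFree {y = y} supp ca v σv≢v with v ∈? y
  ... | yes v∈y = ca v v∈y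
  ... | no v∉y = contradiction (proj₂ (supp v) v∉y) σv≢v

  CaptureFree-∉ : ∀ {σ x v} → CaptureFree σ x → v ∉ x → σ v ∉ x
  CaptureFree-∉ {σ} {x} {v} cf v∉x with σ v ≟ v
  ... | yes σv≡v = subst (_∉ x) (sym σv≡v) v∉x
  ... | no σv≢v = cf v σv≢v

  override-₋ : ∀ {A : Set} {σ} x {e f : Var → A} (g : Var → A) → CaptureFree σ x → f ≗ e ∘ σ →
               override S x f g ≗ override S x e g ∘ _₋_ S σ x
  override-₋ x {e} g cf f≗eσ v with v ∈? x
  ... | yes v∈x = sym (override-∈ e g v∈x)
  ... | no v∉x = trans (f≗eσ v) (sym (override-∉ e g (CaptureFree-∉ cf v∉x)))

  override-++-support : ∀ {A : Set} {σ y} x (e g : Var → A) → HasSupport S σ y →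
                        override S (x ++ y) e (override S x e g ∘ σ) ≗ override S x e g ∘ σ
  override-++-support {σ = σ} {y} x e g supp v with v ∈? (x ++ y)
  ... | yes _ = refl
  ... | no v∉x++y = begin
    e v                     ≡⟨ override-∉ {x = x} e g (v∉x++y ∘ ∈-++⁺ˡ) ⟨
    override S x e g v      ≡⟨ cong (override S x e g) (proj₂ (supp v) (v∉x++y ∘ ∈-++⁺ʳ x)) ⟨
    override S x e g (σ v)  ∎
    where open ≡-Reasoning

  module _ (K : Kripke S) where
    open Kripke K

    Eval-override : ∀ {w e e′} x → Eval S K w e → Eval S K w e′ → Eval S K w (override S x e e′)
    Eval-override x ev ev′ v with v ∈? x
    ... | yes _ = ev′ v
    ... | no _ = ev v

    Eval-mono : ∀ {w w′ e} → w ≤ w′ → Eval S K w e → Eval S K w′ e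
    Eval-mono w≤w′ ev = Dom-mono w≤w′ ∘ ev

    ⊩F : W → (Var → D) → Flower S → Set
    ⊩F = forceF S K

    ⊩C : W → (Var → D) → Corolla S → Set
    ⊩C = forcePetals S K

    ⊩B : W → (Var → D) → Bouquet S → Set
    ⊩B = forceB S K

    ⊩G : W → (Var → D) → Garden S → Set
    ⊩G w e (y · Ψ) = Σ (Var → D) λ e″ → Eval S K w e″ × ⊩B w (override S y e e″) Ψ

    ⊩▷-cong : ∀ {w e f} x x′ {Φ Φ′ Δ Δ′} →
              (∀ {w′} e′ → ⊩B w′ (override S x e e′) Φ ⇔ ⊩B w′ (override S x′ f e′) Φ′) →
              (∀ {w′} e′ → ⊩C w′ (override S x e e′) Δ ⇔ ⊩C w′ (override S x′ f e′) Δ′) →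
              ⊩F w e ((x · Φ) ▷ Δ) ⇔ ⊩F w f ((x′ · Φ′) ▷ Δ′)
    ⊩▷-cong _ _ Φ⇔ Δ⇔ = mk⇔
      (λ h w′ w≤w′ e′ ev′ → to (Δ⇔ e′) ∘ h w′ w≤w′ e′ ev′ ∘ from (Φ⇔ e′))
      (λ h w′ w≤w′ e′ ev′ → from (Δ⇔ e′) ∘ h w′ w≤w′ e′ ev′ ∘ to (Φ⇔ e′))

    ⊩G-cong : ∀ {w e f} y y′ {Ψ Ψ′} →
              (∀ e″ → ⊩B w (override S y e e″) Ψ ⇔ ⊩B w (override S y′ f e″) Ψ′) →
              ⊩G w e (y · Ψ) ⇔ ⊩G w f (y′ · Ψ′)
    ⊩G-cong _ _ Ψ⇔ = mk⇔ (λ (e″ , ev″ , ⊩Ψ) → e″ , ev″ , to (Ψ⇔ e″) ⊩Ψ)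
                         (λ (e″ , ev″ , ⊩Ψ) → e″ , ev″ , from (Ψ⇔ e″) ⊩Ψ)

    ⊩C-∷-cong : ∀ {w e f} γ γ′ {Δ Δ′} → ⊩G w e γ ⇔ ⊩G w f γ′ → ⊩C w e Δ ⇔ ⊩C w f Δ′ →
                ⊩C w e (γ ∷ Δ) ⇔ ⊩C w f (γ′ ∷ Δ′)
    ⊩C-∷-cong (_ · _) (_ · _) = _⊎-⇔_

    ⊩C-swap-cong : ∀ {w e f} γ₁ γ₂ γ₁′ γ₂′ {Δ Δ′} →
                   ⊩G w e γ₁ ⇔ ⊩G w f γ₁′ → ⊩G w e γ₂ ⇔ ⊩G w f γ₂′ → ⊩C w e Δ ⇔ ⊩C w f Δ′ →
                   ⊩C w e (γ₁ ∷ γ₂ ∷ Δ) ⇔ ⊩C w f (γ₂′ ∷ γ₁′ ∷ Δ′)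
    ⊩C-swap-cong (_ · _) (_ · _) (_ · _) (_ · _) = ⊎-swapˡ-⇔

    mutual
      ⊩F-subst : ∀ {w e f} σ φ → CaptureFree σ (bvF S φ) → f ≗ e ∘ σ →
                 ⊩F w e (substF S σ φ) ⇔ ⊩F w f φ
      ⊩F-subst {w} {e} {f} σ (atom p xs) _ f≗eσ = ≡⇒⇔ (cong (⟦ p ⟧ w) (begin
        Vec.map e (Vec.map σ xs)  ≡⟨ Vec.map-∘ e σ xs ⟨
        Vec.map (e ∘ σ) xs        ≡⟨ Vec.map-cong (sym ∘ f≗eσ) xs ⟩
        Vec.map f xs              ∎))
        where open ≡-Reasoning
      ⊩F-subst σ ((x · Φ) ▷ Δ) cf f≗eσ =
        let cfx , cfΦ , cfΔ = CaptureFree-split x (bvB S Φ) (bvC S Δ) cf in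
        ⊩▷-cong x x
          (λ e′ → ⊩B-subst (_₋_ S σ x) Φ (CaptureFree-₋ x cfΦ) (override-₋ x e′ cfx f≗eσ))
          (λ e′ → ⊩C-subst (_₋_ S σ x) Δ (CaptureFree-₋ x cfΔ) (override-₋ x e′ cfx f≗eσ))

      ⊩C-subst : ∀ {w e f} σ Δ → CaptureFree σ (bvC S Δ) → f ≗ e ∘ σ →
                 ⊩C w e (substC S σ Δ) ⇔ ⊩C w f Δ
      ⊩C-subst σ [] _ _ = ⇔.refl
      ⊩C-subst σ ((y · Ψ) ∷ Δ) cf f≗eσ =
        let cfy , cfΨ , cfΔ = CaptureFree-split y (bvB S Ψ) (bvC S Δ) cf in
        ⊩G-cong y y (λ e″ → ⊩B-subst (_₋_ S σ y) Ψ (CaptureFree-₋ y cfΨ) (override-₋ y e″ cfy f≗eσ))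
        ⊎-⇔ ⊩C-subst σ Δ cfΔ f≗eσ

      ⊩B-subst : ∀ {w e f} σ Φ → CaptureFree σ (bvB S Φ) → f ≗ e ∘ σ →
                 ⊩B w e (substB S σ Φ) ⇔ ⊩B w f Φ
      ⊩B-subst σ [] _ _ = ⇔.refl
      ⊩B-subst σ (φ ∷ Φ) cf f≗eσ =
        let cfφ , cfΦ = CaptureFree-++ (bvF S φ) (bvB S Φ) cf in
        ⊩F-subst σ φ cfφ f≗eσ ×-⇔ ⊩B-subst σ Φ cfΦ f≗eσ

    mutual
      ⊩F-resp-≈ : ∀ {w e f φ ψ} → _≈F_ S φ ψ → e ≗ f → ⊩F w e φ ⇔ ⊩F w f ψ
      ⊩F-resp-≈ {w} (atom≈ {p} {xs}) e≗f = ≡⇒⇔ (cong (⟦ p ⟧ w) (Vec.map-cong e≗f xs))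
      ⊩F-resp-≈ (▷≈ {x · _} {x′ · _} (·≈ x⊆x′ x′⊆x Φ↭Φ′) Δ↭Δ′) e≗f = ⊩▷-cong x x′
        (λ e′ → ⊩B-resp-↭ Φ↭Φ′ (override-cong e′ x⊆x′ x′⊆x e≗f))
        (λ e′ → ⊩C-resp-↭ Δ↭Δ′ (override-cong e′ x⊆x′ x′⊆x e≗f))

      ⊩G-resp-≈ : ∀ {w e f γ δ} → _≈G_ S γ δ → e ≗ f → ⊩G w e γ ⇔ ⊩G w f δ
      ⊩G-resp-≈ (·≈ {y} {y′} y⊆y′ y′⊆y Ψ↭Ψ′) e≗f =
        ⊩G-cong y y′ (λ e″ → ⊩B-resp-↭ Ψ↭Ψ′ (override-cong e″ y⊆y′ y′⊆y e≗f))

      ⊩C-resp-Pointwise : ∀ {w e f Δ Δ′} → Pointwise (_≈G_ S) Δ Δ′ → e ≗ f → ⊩C w e Δ ⇔ ⊩C w f Δ′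
      ⊩C-resp-Pointwise [] _ = ⇔.refl
      ⊩C-resp-Pointwise (_∷_ {γ} {γ′} γ≈γ′ Δ≈Δ′) e≗f =
        ⊩C-∷-cong γ γ′ (⊩G-resp-≈ γ≈γ′ e≗f) (⊩C-resp-Pointwise Δ≈Δ′ e≗f)

      ⊩C-resp-↭ : ∀ {w e f Δ Δ′} → Permutation (_≈G_ S) Δ Δ′ → e ≗ f → ⊩C w e Δ ⇔ ⊩C w f Δ′
      ⊩C-resp-↭ (Perm.refl Δ≈Δ′) e≗f = ⊩C-resp-Pointwise Δ≈Δ′ e≗f
      ⊩C-resp-↭ (Perm.prep {x = γ} {γ′} γ≈γ′ Δ↭Δ′) e≗f =
        ⊩C-∷-cong γ γ′ (⊩G-resp-≈ γ≈γ′ e≗f) (⊩C-resp-↭ Δ↭Δ′ e≗f)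
      ⊩C-resp-↭ (Perm.swap {x = γ₁} {γ₂} {γ₁′} {γ₂′} γ₁≈γ₁′ γ₂≈γ₂′ Δ↭Δ′) e≗f =
        ⊩C-swap-cong γ₁ γ₂ γ₁′ γ₂′
          (⊩G-resp-≈ γ₁≈γ₁′ e≗f) (⊩G-resp-≈ γ₂≈γ₂′ e≗f) (⊩C-resp-↭ Δ↭Δ′ e≗f)
      ⊩C-resp-↭ (Perm.trans Δ↭Δ′ Δ′↭Δ″) e≗f =
        ⇔.trans (⊩C-resp-↭ Δ↭Δ′ e≗f) (⊩C-resp-↭ Δ′↭Δ″ λ _ → refl)

      ⊩B-resp-Pointwise : ∀ {w e f Φ Φ′} → Pointwise (_≈F_ S) Φ Φ′ → e ≗ f → ⊩B w e Φ ⇔ ⊩B w f Φ′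
      ⊩B-resp-Pointwise [] _ = ⇔.refl
      ⊩B-resp-Pointwise (φ≈φ′ ∷ Φ≈Φ′) e≗f = ⊩F-resp-≈ φ≈φ′ e≗f ×-⇔ ⊩B-resp-Pointwise Φ≈Φ′ e≗f

      ⊩B-resp-↭ : ∀ {w e f Φ Φ′} → Permutation (_≈F_ S) Φ Φ′ → e ≗ f → ⊩B w e Φ ⇔ ⊩B w f Φ′
      ⊩B-resp-↭ (Perm.refl Φ≈Φ′) e≗f = ⊩B-resp-Pointwise Φ≈Φ′ e≗f
      ⊩B-resp-↭ (Perm.prep φ≈φ′ Φ↭Φ′) e≗f = ⊩F-resp-≈ φ≈φ′ e≗f ×-⇔ ⊩B-resp-↭ Φ↭Φ′ e≗f
      ⊩B-resp-↭ (Perm.swap φ₁≈φ₁′ φ₂≈φ₂′ Φ↭Φ′) e≗f =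
        ×-swapˡ-⇔ (⊩F-resp-≈ φ₁≈φ₁′ e≗f) (⊩F-resp-≈ φ₂≈φ₂′ e≗f) (⊩B-resp-↭ Φ↭Φ′ e≗f)
      ⊩B-resp-↭ (Perm.trans Φ↭Φ′ Φ′↭Φ″) e≗f =
        ⇔.trans (⊩B-resp-↭ Φ↭Φ′ e≗f) (⊩B-resp-↭ Φ′↭Φ″ λ _ → refl)

    infix 4 _⊨ᴷ_
    _⊨ᴷ_ : Bouquet S → Bouquet S → Set
    Φ ⊨ᴷ Ψ = ∀ {w e} → Eval S K w e → ⊩B w e Φ → ⊩B w e Ψ

    ⊨ᴷ-[] : ∀ Φ → Φ ⊨ᴷ []
    ⊨ᴷ-[] _ _ _ = tt

    ⊨ᴷ-++ˡ : ∀ Ψ {A B} → A ⊨ᴷ B → Ψ ++ A ⊨ᴷ Ψ ++ B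
    ⊨ᴷ-++ˡ [] A⊨B = A⊨B
    ⊨ᴷ-++ˡ (φ ∷ Ψ) A⊨B ev (⊩φ , ⊩Ψ++A) = ⊩φ , ⊨ᴷ-++ˡ Ψ A⊨B ev ⊩Ψ++A

    pistil-antitone : ∀ x Δ {A B} → A ⊨ᴷ B → [ (x · B) ▷ Δ ] ⊨ᴷ [ (x · A) ▷ Δ ]
    pistil-antitone x Δ A⊨B ev (⊩▷ , tt) =
      (λ w′ w≤w′ e′ ev′ → ⊩▷ w′ w≤w′ e′ ev′ ∘ A⊨B (Eval-override x (Eval-mono w≤w′ ev) ev′)) , tt

    petal-entails : ∀ γ δ δ′ Δ → (∀ {w e} → Eval S K w e → ⊩G w e δ → ⊩G w e δ′) →
                    [ γ ▷ (δ ∷ Δ) ] ⊨ᴷ [ γ ▷ (δ′ ∷ Δ) ]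
    petal-entails (z · _) (_ · _) (_ · _) _ δ⇒δ′ ev (⊩▷ , tt) =
      (λ w′ w≤w′ e′ ev′ →
        Sum.map₁ (δ⇒δ′ (Eval-override z (Eval-mono w≤w′ ev) ev′)) ∘ ⊩▷ w′ w≤w′ e′ ev′) , tt

    petal-monotone : ∀ γ x Δ {A B} → A ⊨ᴷ B → [ γ ▷ ((x · A) ∷ Δ) ] ⊨ᴷ [ γ ▷ ((x · B) ∷ Δ) ]
    petal-monotone γ x Δ {A} {B} A⊨B = petal-entails γ (x · A) (x · B) Δ
      λ ev (e″ , ev″ , ⊩A) → e″ , ev″ , A⊨B (Eval-override x ev ev″) ⊩A

    mutual
      fill-monotone : ∀ Ξ {A B} → Positive S Ξ → A ⊨ᴷ B → fill S Ξ A ⊨ᴷ fill S Ξ B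
      fill-monotone (Ψ ,, □) _ A⊨B = ⊨ᴷ-++ˡ Ψ A⊨B
      fill-monotone (Ψ ,, pist x Ξ Δ) pos A⊨B =
        ⊨ᴷ-++ˡ Ψ (pistil-antitone x Δ (fill-antitone Ξ (even-suc⇒odd (inv S Ξ) pos) A⊨B))
      fill-monotone (Ψ ,, petal γ x Ξ Δ) pos A⊨B =
        ⊨ᴷ-++ˡ Ψ (petal-monotone γ x Δ (fill-monotone Ξ pos A⊨B))

      fill-antitone : ∀ Ξ {A B} → Negative S Ξ → A ⊨ᴷ B → fill S Ξ B ⊨ᴷ fill S Ξ A
      fill-antitone (Ψ ,, pist x Ξ Δ) neg A⊨B =
        ⊨ᴷ-++ˡ Ψ (pistil-antitone x Δ (fill-monotone Ξ (odd-suc⇒even (inv S Ξ) neg) A⊨B))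
      fill-antitone (Ψ ,, petal γ x Ξ Δ) neg A⊨B =
        ⊨ᴷ-++ˡ Ψ (petal-monotone γ x Δ (fill-antitone Ξ neg A⊨B))

    ⊩C-++⁺ʳ : ∀ {w e} Γ {Δ} → ⊩C w e Δ → ⊩C w e (Γ ++ Δ)
    ⊩C-++⁺ʳ [] ⊩Δ = ⊩Δ
    ⊩C-++⁺ʳ ((_ · _) ∷ Γ) ⊩Δ = inj₂ (⊩C-++⁺ʳ Γ ⊩Δ)

    pull-sound : ∀ γ Γ Δ → [ γ ▷ Δ ] ⊨ᴷ [ γ ▷ (Γ ++ Δ) ]
    pull-sound (_ · _) Γ _ _ (⊩▷ , tt) = (λ w′ w≤w′ e′ ev′ → ⊩C-++⁺ʳ Γ ∘ ⊩▷ w′ w≤w′ e′ ev′) , tt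

    apis-sound : ∀ {σ} x y Φ Δ → HasSupport S σ y → CaptureAvoiding S σ y (bvB S Φ ++ bvC S Δ) →
                 [ ((x ++ y) · Φ) ▷ Δ ] ⊨ᴷ [ (x · substB S σ Φ) ▷ substC S σ Δ ]
    apis-sound {σ} x y Φ Δ supp ca {e = e} ev (⊩▷ , tt) =
      let cfΦ , cfΔ = CaptureFree-++ (bvB S Φ) (bvC S Δ) (CaptureAvoiding⇒CaptureFree supp ca) in
      (λ w′ w≤w′ e′ ev′ →
        let absorbs = override-++-support x e e′ supp in
        from (⊩C-subst σ Δ cfΔ absorbs)
        ∘ ⊩▷ w′ w≤w′ (override S x e e′ ∘ σ) (Eval-override x (Eval-mono w≤w′ ev) ev′ ∘ σ)
        ∘ to (⊩B-subst σ Φ cfΦ absorbs)) , tt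

    apet-sound : ∀ {σ} x y Φ → HasSupport S σ y → CaptureAvoiding S σ y (bvB S Φ) →
                 ∀ {w e} → Eval S K w e → ⊩G w e (x · substB S σ Φ) → ⊩G w e ((x ++ y) · Φ)
    apet-sound {σ} x y Φ supp ca {e = e} ev (e″ , ev″ , ⊩σΦ) =
      override S x e e″ ∘ σ , Eval-override x ev ev″ ∘ σ ,
      to (⊩B-subst σ Φ (CaptureAvoiding⇒CaptureFree supp ca) (override-++-support x e e″ supp)) ⊩σΦ

    cultural-sound : ∀ {Φ Ψ} → _⟶ᶜ_ S Φ Ψ → Ψ ⊨ᴷ Φ
    cultural-sound (grow {Ξ} {Φ} pos) = fill-monotone Ξ pos (⊨ᴷ-[] Φ)
    cultural-sound (crop {Ξ} {Φ} neg) = fill-antitone Ξ neg (⊨ᴷ-[] Φ)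
    cultural-sound (pull {Ξ} {γ} {Γ} {Δ} pos) = fill-monotone Ξ pos (pull-sound γ Γ Δ)
    cultural-sound (glue {Ξ} {γ} {Γ} {Δ} neg) = fill-antitone Ξ neg (pull-sound γ Γ Δ)
    cultural-sound (apis {Ξ} {x} {y} {Φ = Φ} {Δ} pos supp ca) =
      fill-monotone Ξ pos (apis-sound x y Φ Δ supp ca)
    cultural-sound (apet {Ξ} {γ} {x} {y} {Φ = Φ} {Δ} neg supp ca) =
      fill-antitone Ξ neg (petal-entails γ _ _ Δ (apet-sound x y Φ supp ca))

mainTheorem12 : (S : Signature) → (Φ Ψ : Bouquet S) →
    WellFormed S Φ → WellFormed S Ψ →
    _⟶C_ S Φ Ψ → _⊨_ S Ψ Φ
mainTheorem12 S Φ Ψ _ _ (Φ′ , Ψ′ , Φ↭Φ′ , Ψ↭Ψ′ , Φ′⟶Ψ′) K w e ev =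
  from (⊩B-resp-↭ S K Φ↭Φ′ λ _ → refl)
  ∘ cultural-sound S K Φ′⟶Ψ′ ev
  ∘ to (⊩B-resp-↭ S K Ψ↭Ψ′ λ _ → refl)
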